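{- Let $\mathbf{Q}$ be a quantale, $X,Y$ non-empty sets and $p\in Q^{X\times Y}$ a strong coder. Let $H_p:Q^X\to Q^Y$, $H_pf(y)=\bigvee_{x\in X}f(x)\cdot p(x,y)$, and $\Lambda_p:Q^Y\to Q^X$, $\Lambda_pg(x)=\bigwedge_{y\in Y}g(y)/p(x,y)$. Then $H_p\circ\Lambda_p=\mathrm{id}_{Q^Y}$; consequently $H_p$ is surjective and $\Lambda_p$ is injective.
   Context: A quantale is $\mathbf{Q}=\langle Q,\vee,\cdot,\bot,e\rangle$ with $\langle Q,\vee,\bot\rangle$ a complete lattice, $\langle Q,\cdot,e\rangle$ a monoid, multiplication distributing over arbitrary joins on both sides; $y/x=\bigvee\{z\mid zx\le y\}$. A map $p\in Q^{X\times Y}$ is a strong coder if there is an injective map $\varepsilon:Y\to X$ with $p(\varepsilon(y),y)=e$ for all $y\in Y$ and $p(\varepsilon(y_1),y_2)=\bot$ for all $y_1\neq y_2$ in $Y$. -}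

module Defs where

open import Level using (Level; suc; Lift)
open import Data.Empty using (⊥)
open import Data.Product using (Σ; _×_; _,_; proj₁)
open import Relation.Binary.PropositionalEquality using (_≡_)
open import Relation.Nullary using (¬_)
open import Function.Definitions using (Injective)

record Quantale (c : Level) : Set (suc c) where
  infix  4 _≤_
  infixl 7 _·_
  field
    Carrier   : Set c
    _≤_       : Carrier → Carrier → Set c
    ≤-refl    : ∀ {a} → a ≤ a
    ≤-trans   : ∀ {a b d} → a ≤ b → b ≤ d → a ≤ d
    ≤-antisym : ∀ {a b} → a ≤ b → b ≤ a → a ≡ b
    ⋁         : {I : Set c} → (I → Carrier) → Carrier
    ⋁-upper   : {I : Set c} (f : I → Carrier) (i : I) → f i ≤ ⋁ f
    ⋁-least   : {I : Set c} (f : I → Carrier) (b : Carrier) →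
                (∀ i → f i ≤ b) → ⋁ f ≤ b
    _·_       : Carrier → Carrier → Carrier
    e         : Carrier
    ·-assoc   : ∀ a b d → (a · b) · d ≡ a · (b · d)
    ·-identityˡ : ∀ a → e · a ≡ a
    ·-identityʳ : ∀ a → a · e ≡ a
    ·-distribˡ-⋁ : ∀ a {I : Set c} (f : I → Carrier) → a · ⋁ f ≡ ⋁ (λ i → a · f i)
    ·-distribʳ-⋁ : ∀ a {I : Set c} (f : I → Carrier) → ⋁ f · a ≡ ⋁ (λ i → f i · a)

  ⊥Q : Carrier
  ⊥Q = ⋁ {I = Lift c ⊥} (λ ())

  ⋀ : {I : Set c} → (I → Carrier) → Carrier
  ⋀ {I} f = ⋁ {I = Σ Carrier (λ z → ∀ i → z ≤ f i)} proj₁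

  _/_ : Carrier → Carrier → Carrier
  y / x = ⋁ {I = Σ Carrier (λ z → z · x ≤ y)} proj₁

module _ {c : Level} (Q : Quantale c) where
  open Quantale Q

  IsStrongCoder : {X Y : Set c} → (X → Y → Carrier) → Set c
  IsStrongCoder {X} {Y} p =
    Σ (Y → X) λ ε →
      Injective _≡_ _≡_ ε
      × (∀ y → p (ε y) y ≡ e)
      × (∀ y₁ y₂ → ¬ (y₁ ≡ y₂) → p (ε y₁) y₂ ≡ ⊥Q)

  H : {X Y : Set c} → (X → Y → Carrier) → (X → Carrier) → (Y → Carrier)
  H {X} p f y = ⋁ {I = X} (λ x → f x · p x y)

  Λ : {X Y : Set c} → (X → Y → Carrier) → (Y → Carrier) → (X → Carrier)
  Λ {Y = Y} p g x = ⋀ {I = Y} (λ y → g y / p x y)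

module Submission where

open import Defs
open import Level using (Level)
open import Data.Product using (Σ; _×_; _,_; proj₁; proj₂)
open import Relation.Binary.PropositionalEquality
  using (_≡_; refl; sym; trans; subst; cong; module ≡-Reasoning)
open import Relation.Binary.Definitions using (DecidableEquality)
open import Relation.Nullary using (yes; no)
open import Axiom.ExcludedMiddle using (ExcludedMiddle)

-- H p ∘ Λ p is always deflationary, since (a / b) · b ≤ a.  For the converse,
-- the row of p at ε y is the indicator of y (e at y, ⊥ elsewhere), so g y is
-- below every g y′ / p (ε y) y′; hence g y ≤ Λ p g (ε y) = Λ p g (ε y) · p (ε y) y,
-- one of the joinands of H p (Λ p g) y.

module QuantaleProperties {c : Level} (Q : Quantale c) where
  open Quantale Q

  ≡⇒≤ : ∀ {a b} → a ≡ b → a ≤ b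
  ≡⇒≤ refl = ≤-refl

  ⋁-≤-self : ∀ a → ⋁ {I = Σ Carrier (λ z → z ≤ a)} proj₁ ≡ a
  ⋁-≤-self a = ≤-antisym (⋁-least _ a proj₂) (⋁-upper _ (a , ≤-refl))

  ·-monoˡ-≤ : ∀ {a a′} b → a ≤ a′ → a · b ≤ a′ · b
  ·-monoˡ-≤ {a} {a′} b a≤a′ = ≤-trans (⋁-upper (λ i → proj₁ i · b) (a , a≤a′))
    (≡⇒≤ (trans (sym (·-distribʳ-⋁ b proj₁)) (cong (_· b) (⋁-≤-self a′))))

  /-counit : ∀ a b → (a / b) · b ≤ a
  /-counit a b = ≤-trans (≡⇒≤ (·-distribʳ-⋁ b proj₁)) (⋁-least _ a proj₂)

  /-unit : ∀ {z a b} → z · b ≤ a → z ≤ a / b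
  /-unit {z} zb≤a = ⋁-upper proj₁ (z , zb≤a)

  ⋀-lower : ∀ {I : Set c} (f : I → Carrier) i → ⋀ f ≤ f i
  ⋀-lower f i = ⋁-least _ (f i) (λ j → proj₂ j i)

  ⋀-greatest : ∀ {I : Set c} (f : I → Carrier) {b} → (∀ i → b ≤ f i) → b ≤ ⋀ f
  ⋀-greatest f {b} b≤f = ⋁-upper proj₁ (b , b≤f)

  ⋁-cong : ∀ {I : Set c} {f g : I → Carrier} → (∀ i → f i ≡ g i) → ⋁ f ≡ ⋁ g
  ⋁-cong {f = f} {g} f≗g = ≤-antisym
    (⋁-least f _ (λ i → subst (_≤ ⋁ g) (sym (f≗g i)) (⋁-upper g i)))
    (⋁-least g _ (λ i → subst (_≤ ⋁ f) (f≗g i) (⋁-upper f i)))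

  ·-zeroʳ-≤ : ∀ a b → a · ⊥Q ≤ b
  ·-zeroʳ-≤ a b = ≤-trans (≡⇒≤ (·-distribˡ-⋁ a _)) (⋁-least _ b (λ ()))

module _ {c : Level} (Q : Quantale c) {X Y : Set c} where
  open Quantale Q
  open QuantaleProperties Q

  H-cong : (p : X → Y → Carrier) {f₁ f₂ : X → Carrier} →
           (∀ x → f₁ x ≡ f₂ x) → ∀ y → H Q p f₁ y ≡ H Q p f₂ y
  H-cong p f₁≗f₂ y = ⋁-cong (λ x → cong (_· p x y) (f₁≗f₂ x))

  H∘Λ-deflationary : (p : X → Y → Carrier) (g : Y → Carrier) →
                     ∀ y → H Q p (Λ Q p g) y ≤ g y
  H∘Λ-deflationary p g y = ⋁-least _ (g y) λ x →
    ≤-trans (·-monoˡ-≤ (p x y) (⋀-lower (λ y′ → g y′ / p x y′) y)) (/-counit (g y) (p x y))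

  H∘Λ-inflationary : DecidableEquality Y → (p : X → Y → Carrier) → IsStrongCoder Q p →
                     (g : Y → Carrier) → ∀ y → g y ≤ H Q p (Λ Q p g) y
  H∘Λ-inflationary _≟_ p (ε , _ , p-diag , p-offdiag) g y =
    ≤-trans (⋀-greatest (λ y′ → g y′ / p (ε y) y′) g-below-row)
      (≤-trans (≡⇒≤ (sym (trans (cong (Λ Q p g (ε y) ·_) (p-diag y)) (·-identityʳ _))))
        (⋁-upper (λ x → Λ Q p g x · p x y) (ε y)))
    where
    g-below-row : ∀ y′ → g y ≤ g y′ / p (ε y) y′
    g-below-row y′ with y ≟ y′
    ... | yes refl = /-unit (subst (λ t → g y · t ≤ g y) (sym (p-diag y)) (≡⇒≤ (·-identityʳ (g y))))
    ... | no y≢y′  = /-unit (subst (λ t → g y · t ≤ g y′) (sym (p-offdiag y y′ y≢y′))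
                                   (·-zeroʳ-≤ (g y) (g y′)))

  H∘Λ≗id : DecidableEquality Y → (p : X → Y → Carrier) → IsStrongCoder Q p →
           (g : Y → Carrier) → ∀ y → H Q p (Λ Q p g) y ≡ g y
  H∘Λ≗id _≟_ p coder g y =
    ≤-antisym (H∘Λ-deflationary p g y) (H∘Λ-inflationary _≟_ p coder g y)

  Λ-injective : (p : X → Y → Carrier) →
    ((g : Y → Carrier) → ∀ y → H Q p (Λ Q p g) y ≡ g y) →
    (g₁ g₂ : Y → Carrier) → (∀ x → Λ Q p g₁ x ≡ Λ Q p g₂ x) → ∀ y → g₁ y ≡ g₂ y
  Λ-injective p H∘Λ≗id g₁ g₂ Λg₁≗Λg₂ y = begin
    g₁ y                ≡⟨ sym (H∘Λ≗id g₁ y) ⟩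
    H Q p (Λ Q p g₁) y  ≡⟨ H-cong p Λg₁≗Λg₂ y ⟩
    H Q p (Λ Q p g₂) y  ≡⟨ H∘Λ≗id g₂ y ⟩
    g₂ y                ∎
    where open ≡-Reasoning

theorem5p12 : {c : Level} → ExcludedMiddle c → (Q : Quantale c) →
    (X Y : Set c) → X → Y → (p : X → Y → Quantale.Carrier Q) →
    IsStrongCoder Q p →
    ((g : Y → Quantale.Carrier Q) → ∀ y → H Q p (Λ Q p g) y ≡ g y)
    × ((g : Y → Quantale.Carrier Q) → Σ (X → Quantale.Carrier Q) (λ f → ∀ y → H Q p f y ≡ g y))
    × ((g₁ g₂ : Y → Quantale.Carrier Q) → (∀ x → Λ Q p g₁ x ≡ Λ Q p g₂ x) → ∀ y → g₁ y ≡ g₂ y)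
-- Excluded middle is only needed to decide equality on Y.
theorem5p12 em Q X Y _ _ p coder =
  retraction , (λ g → Λ Q p g , retraction g) , Λ-injective Q p retraction
  where
  retraction : (g : Y → Quantale.Carrier Q) → ∀ y → H Q p (Λ Q p g) y ≡ g y
  retraction = H∘Λ≗id Q (λ _ _ → em) p coder
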